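{- There exists a unique representation basis $A \subseteq \mathbb{Z}$ for the integers such that $A(-x,x) \ge \frac{1}{8}x^{1/3}$ for all sufficiently large real numbers $x$.
   Context: For $A \subseteq \mathbb{Z}$ and $n \in \mathbb{Z}$, let $r_A(n)$ be the number of pairs $(a,a')$ with $a,a' \in A$, $a \le a'$ and $a+a'=n$. A set $A \subseteq \mathbb{Z}$ is a unique representation basis for the integers if $r_A(n)=1$ for every $n \in \mathbb{Z}$. For real $y \le x$, $A(y,x) = |A \cap [y,x]|$. -}

module Defs where

open import Level using (0ℓ)
open import Data.Nat as ℕ using (ℕ; _^_)
open import Data.Integer as ℤ using (ℤ; +_; -_; _+_; _≤_)
open import Data.Fin using (Fin)
open import Data.Product using (Σ; _×_; _,_; ∃)
open import Relation.Binary.PropositionalEquality using (_≡_)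
open import Function.Definitions using (Injective)

SetZ : Set₁
SetZ = ℤ → Set

Rep : SetZ → ℤ → Set
Rep A n = Σ ℤ λ a → Σ ℤ λ a' → A a × A a' × a ≤ a' × a + a' ≡ n

UniqueRep : SetZ → ℤ → Set
UniqueRep A n =
  Σ ℤ λ a → Σ ℤ λ a' → (A a × A a' × a ≤ a' × a + a' ≡ n) ×
    (∀ b b' → A b → A b' → b ≤ b' → b + b' ≡ n → (b ≡ a × b' ≡ a'))

IsUniqueRepBasis : SetZ → Set
IsUniqueRepBasis A = ∀ n → UniqueRep A n

-- A(-n, n) ≥ m : A ∩ [-n, n] contains at least m distinct elements.
AtLeast : SetZ → ℕ → ℕ → Set
AtLeast A n m =
  Σ (Fin m → ℤ) λ f → Injective _≡_ _≡_ f ×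
    (∀ i → A (f i) × - (+ n) ≤ f i × f i ≤ + n)

{-# OPTIONS --safe #-}
-- A greedy construction of a Sidon set whose sumset is all of ℤ.  Stage k first makes the k-th
-- integer t in the order 0, -1, 1, -2, … a sum, if it is not one already, by adding a pair
-- x, t - x; then it adds one non-negative element w_k.  Adding a new element keeps the set Sidon
-- unless one of finitely many linear equations k x = c (1 ≤ k ≤ 4, c determined by the old set)
-- holds, so only finitely many values of ∣ x ∣ are excluded.  For w_k these are at most s³ + s²
-- values, where s ≤ 3k + 2 is the current size, so by pigeonhole w_k ≤ (3k + 3)³.  The union is
-- a unique representation basis, and w_0, …, w_{m-1} are m distinct elements of [0, (4m)³].
module Submission where

open import Defs

module FreshNumbers where

  open import Data.Nat using (ℕ; suc; _<_; _≤_; s≤s⁻¹)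
  open import Data.Nat.Properties using (_≟_; ≤-refl; <-≤-trans; m<n⇒m<1+n; <⇒≢)
  open import Data.List using (List; length; filter; concat)
  open import Data.List.Properties using (filter-notAll)
  import Data.List.Relation.Unary.Any as Any
  open import Data.List.Relation.Unary.All using (All; tabulate)
  open import Data.List.Membership.Propositional using (_∉_)
  open import Data.List.Membership.Propositional.Properties using (∈-filter⁺; ∈-concat⁺′)
  open import Data.List.Membership.DecPropositional _≟_ using (_∈?_)
  open import Data.Product using (∃; _×_; _,_; proj₁; proj₂)
  open import Function using (_∘_)
  open import Relation.Nullary using (yes; no; ¬?)
  open import Relation.Binary.PropositionalEquality using (sym)

  ∃-∉-below : ∀ n (F : List ℕ) → length F < n → ∃ λ w → w < n × w ∉ F
  ∃-∉-below (suc n) F |F|<1+n with n ∈? F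
  ... | no n∉F = n , ≤-refl , n∉F
  ... | yes n∈F = below-n (∃-∉-below n F′ F′-shorter)
    where
    F′ : List ℕ
    F′ = filter (¬? ∘ (_≟ n)) F
    F′-shorter : length F′ < n
    F′-shorter = <-≤-trans
      (filter-notAll (¬? ∘ (_≟ n)) F (Any.map (λ n≡y y≢n → y≢n (sym n≡y)) n∈F))
      (s≤s⁻¹ |F|<1+n)
    below-n : (∃ λ w → w < n × w ∉ F′) → ∃ λ w → w < suc n × w ∉ F
    below-n (w , w<n , w∉F′) =
      w , m<n⇒m<1+n w<n , λ w∈F → w∉F′ (∈-filter⁺ (¬? ∘ (_≟ n)) w∈F (<⇒≢ w<n))

  private
    fresh-spec : ∀ Fs → ∃ λ w → w < suc (length (concat Fs)) × w ∉ concat Fs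
    fresh-spec Fs = ∃-∉-below (suc (length (concat Fs))) (concat Fs) ≤-refl

  fresh : List (List ℕ) → ℕ
  fresh Fs = proj₁ (fresh-spec Fs)

  fresh-≤ : ∀ Fs → fresh Fs ≤ length (concat Fs)
  fresh-≤ Fs = s≤s⁻¹ (proj₁ (proj₂ (fresh-spec Fs)))

  fresh-∉ : ∀ Fs → All (fresh Fs ∉_) Fs
  fresh-∉ Fs = tabulate λ F∈Fs w∈F → proj₂ (proj₂ (fresh-spec Fs)) (∈-concat⁺′ w∈F F∈Fs)

module SidonSets where

  open import Data.Nat as ℕ using (ℕ; _⊔_)
  open import Data.Nat.Properties using (m≤m⊔n; m≤n⊔m) renaming (≤-trans to ≤ℕ-trans)
  open import Data.Integer using (ℤ; _+_; _≤_)
  open import Data.Integer.Properties using (+-comm; ≤-antisym; ≤-total; +-0-abelianGroup)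
  open import Algebra.Properties.AbelianGroup +-0-abelianGroup using (∙-cancelˡ)
  open import Data.List using (List; _∷_; cartesianProductWith)
  open import Data.List.Relation.Unary.Any using (here; there)
  open import Data.List.Membership.Propositional using (_∈_; _∉_)
  open import Data.List.Membership.Propositional.Properties
    using (∈-cartesianProductWith⁺; ∈-cartesianProductWith⁻)
  open import Data.List.Relation.Binary.Subset.Propositional using (_⊆_)
  open import Data.Product using (∃; _×_; _,_)
  open import Data.Sum using (_⊎_; inj₁; inj₂)
  open import Data.Empty using (⊥-elim)
  open import Relation.Binary.PropositionalEquality using (_≡_; refl; sym; trans)

  SamePair : ℤ → ℤ → ℤ → ℤ → Set
  SamePair a a' b b' = (a ≡ b × a' ≡ b') ⊎ (a ≡ b' × a' ≡ b)

  SamePair-swapˡ : ∀ {a a' b b'} → SamePair a a' b b' → SamePair a' a b b'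
  SamePair-swapˡ (inj₁ (a≡b , a'≡b')) = inj₂ (a'≡b' , a≡b)
  SamePair-swapˡ (inj₂ (a≡b' , a'≡b)) = inj₁ (a'≡b , a≡b')

  SamePair-sym : ∀ {a a' b b'} → SamePair a a' b b' → SamePair b b' a a'
  SamePair-sym (inj₁ (a≡b , a'≡b')) = inj₁ (sym a≡b , sym a'≡b')
  SamePair-sym (inj₂ (a≡b' , a'≡b)) = inj₂ (sym a'≡b , sym a≡b')

  SidonSet : SetZ → Set
  SidonSet A = ∀ {a a' b b'} → A a → A a' → A b → A b' → a + a' ≡ b + b' → SamePair a a' b b'

  Sidon : List ℤ → Set
  Sidon A = SidonSet (_∈ A)

  Sidon⇒UniqueRep : ∀ {A n} → SidonSet A → Rep A n → UniqueRep A n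
  Sidon⇒UniqueRep {A} {n} sidon (a , a' , Aa , Aa' , a≤a' , a+a'≡n) =
    a , a' , (Aa , Aa' , a≤a' , a+a'≡n) , unique
    where
    unique : ∀ b b' → A b → A b' → b ≤ b' → b + b' ≡ n → b ≡ a × b' ≡ a'
    unique b b' Ab Ab' b≤b' b+b'≡n with sidon Ab Ab' Aa Aa' (trans b+b'≡n (sym a+a'≡n))
    ... | inj₁ same = same
    ... | inj₂ (refl , refl) = sym a≡a' , a≡a'
      where a≡a' = ≤-antisym a≤a' b≤b'

  sums : List ℤ → List ℤ
  sums A = cartesianProductWith _+_ A A

  ∈-sums⁺ : ∀ {A a a' e} → a ∈ A → a' ∈ A → e ≡ a + a' → e ∈ sums A
  ∈-sums⁺ {A} a∈A a'∈A refl = ∈-cartesianProductWith⁺ _+_ a∈A a'∈A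

  ∈-sums-∷⁻ : ∀ {v A e} → e ∈ sums (v ∷ A) →
              e ≡ v + v ⊎ (∃ λ d → d ∈ A × e ≡ v + d) ⊎ e ∈ sums A
  ∈-sums-∷⁻ {v} {A} e∈ with ∈-cartesianProductWith⁻ _+_ (v ∷ A) (v ∷ A) e∈
  ... | _ , _ , here refl , here refl , e≡ = inj₁ e≡
  ... | _ , d , here refl , there d∈A , e≡ = inj₂ (inj₁ (d , d∈A , e≡))
  ... | d , _ , there d∈A , here refl , e≡ = inj₂ (inj₁ (d , d∈A , trans e≡ (+-comm d v)))
  ... | _ , _ , there d∈A , there d'∈A , e≡ = inj₂ (inj₂ (∈-sums⁺ d∈A d'∈A e≡))

  ∈-sums⇒Rep : ∀ {A : SetZ} {B n} → (∀ {z} → z ∈ B → A z) → n ∈ sums B → Rep A n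
  ∈-sums⇒Rep {B = B} B⊆A n∈
    with d , d' , d∈B , d'∈B , refl ← ∈-cartesianProductWith⁻ _+_ B B n∈ | ≤-total d d'
  ... | inj₁ d≤d' = d , d' , B⊆A d∈B , B⊆A d'∈B , d≤d' , refl
  ... | inj₂ d'≤d = d' , d , B⊆A d'∈B , B⊆A d∈B , d'≤d , +-comm d' d

  Admissible : ℤ → List ℤ → Set
  Admissible x A = (∀ {a} → a ∈ A → x + a ∉ sums A) × x + x ∉ sums A

  Admissible⇒∉ : ∀ {x A} → Admissible x A → x ∉ A
  Admissible⇒∉ (_ , x+x∉) x∈A = x+x∉ (∈-sums⁺ x∈A x∈A refl)

  Sidon-∷ : ∀ {x A} → Sidon A → Admissible x A → Sidon (x ∷ A)
  Sidon-∷ {x} {A} sidon (x+A∉ , x+x∉) = sidon-∷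
    where
    through-x : ∀ {a' b b'} → a' ∈ x ∷ A → b ∈ x ∷ A → b' ∈ x ∷ A →
                x + a' ≡ b + b' → SamePair x a' b b'
    through-x _ (here refl) _ eq = inj₁ (refl , ∙-cancelˡ x _ _ eq)
    through-x _ (there _) (here refl) eq = inj₂ (refl , ∙-cancelˡ x _ _ (trans eq (+-comm _ x)))
    through-x (here refl) (there b∈A) (there b'∈A) eq = ⊥-elim (x+x∉ (∈-sums⁺ b∈A b'∈A eq))
    through-x (there a'∈A) (there b∈A) (there b'∈A) eq = ⊥-elim (x+A∉ a'∈A (∈-sums⁺ b∈A b'∈A eq))

    sidon-∷ : Sidon (x ∷ A)
    sidon-∷ (here refl) a' b b' eq = through-x a' b b' eq
    sidon-∷ (there a) (here refl) b b' eq =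
      SamePair-swapˡ (through-x (there a) b b' (trans (+-comm x _) eq))
    sidon-∷ (there a) (there a') (here refl) b' eq =
      SamePair-sym (through-x b' (there a) (there a') (sym eq))
    sidon-∷ (there a) (there a') (there b) (here refl) eq =
      SamePair-sym (SamePair-swapˡ
        (through-x (there b) (there a) (there a') (trans (+-comm x _) (sym eq))))
    sidon-∷ (there a) (there a') (there b) (there b') eq = sidon a a' b b' eq

  ⋃ : (ℕ → List ℤ) → SetZ
  ⋃ As z = ∃ λ k → z ∈ As k

  Sidon-⋃ : ∀ {As} → (∀ {j k} → j ℕ.≤ k → As j ⊆ As k) → (∀ k → Sidon (As k)) → SidonSet (⋃ As)
  Sidon-⋃ mono sidon (k₁ , a) (k₂ , a') (k₃ , b) (k₄ , b') =
    sidon ((k₁ ⊔ k₂) ⊔ (k₃ ⊔ k₄))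
      (mono (≤ℕ-trans (m≤m⊔n k₁ k₂) (m≤m⊔n _ _)) a)
      (mono (≤ℕ-trans (m≤n⊔m k₁ k₂) (m≤m⊔n _ _)) a')
      (mono (≤ℕ-trans (m≤m⊔n k₃ k₄) (m≤n⊔m (k₁ ⊔ k₂) _)) b)
      (mono (≤ℕ-trans (m≤n⊔m k₃ k₄) (m≤n⊔m (k₁ ⊔ k₂) _)) b')

module Construction where

  open FreshNumbers
  open SidonSets

  open import Data.Nat as ℕ using (ℕ; zero; suc; NonZero; _/_)
  open import Data.Nat.DivMod using (m*n/n≡m)
  import Data.Nat.Properties as ℕ
  open import Data.Integer using (ℤ; +_; -[1+_]; ∣_∣; _+_; _-_; _*_)
  open import Data.Integer.Properties using (abs-*; +-0-abelianGroup; _≟_)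
  open import Algebra.Properties.AbelianGroup +-0-abelianGroup using (∙-cancelʳ)
  open import Data.Integer.Tactic.RingSolver using (solve; solve-∀)
  open import Data.List using (List; []; _∷_; [_]; map; length; cartesianProductWith)
  open import Data.List.Relation.Unary.Any using (here; there)
  open import Data.List.Relation.Unary.All as All using (All)
  open import Data.List.Membership.Propositional using (_∈_; _∉_)
  open import Data.List.Membership.Propositional.Properties using (∈-map⁺; ∈-cartesianProductWith⁺)
  open import Data.List.Membership.DecPropositional _≟_ using (_∈?_)
  open import Data.List.Relation.Binary.Subset.Propositional using (_⊆_)
  open import Data.Product as Product using (∃; _×_; _,_; proj₁; proj₂)
  open import Data.Sum using (inj₁; inj₂)
  open import Data.Empty using (⊥-elim)
  open import Function.Definitions using (Injective)
  open import Relation.Nullary using (yes; no)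
  open import Relation.Binary.Definitions using (tri<; tri≈; tri>)
  open import Relation.Binary.PropositionalEquality
    using (_≡_; _≢_; refl; sym; cong; trans; subst; module ≡-Reasoning)

  roots : (k : ℕ) .{{_ : NonZero k}} → List ℤ → List ℕ
  roots k = map (λ c → ∣ c ∣ / k)

  ∈-roots : ∀ k .{{_ : NonZero k}} x {c cs} → c ∈ cs → + k * x ≡ c → ∣ x ∣ ∈ roots k cs
  ∈-roots k x c∈cs refl = subst (_∈ roots k _) ∣kx∣/k≡∣x∣ (∈-map⁺ _ c∈cs)
    where
    open ≡-Reasoning
    ∣kx∣/k≡∣x∣ : ∣ + k * x ∣ / k ≡ ∣ x ∣
    ∣kx∣/k≡∣x∣ = begin
      ∣ + k * x ∣ / k    ≡⟨ cong (_/ k) (abs-* (+ k) x) ⟩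
      k ℕ.* ∣ x ∣ / k    ≡⟨ cong (_/ k) (ℕ.*-comm k ∣ x ∣) ⟩
      ∣ x ∣ ℕ.* k / k    ≡⟨ m*n/n≡m ∣ x ∣ k ⟩
      ∣ x ∣              ∎

  -- An equation L ≡ R that the ring identity k x + R ≡ c + L turns into k x = c.
  ∈-roots′ : ∀ k .{{_ : NonZero k}} x {c cs L R} → L ≡ R → c ∈ cs → + k * x + R ≡ c + L →
             ∣ x ∣ ∈ roots k cs
  ∈-roots′ k x {c} {R = R} L≡R c∈cs identity =
    ∈-roots k x c∈cs (∙-cancelʳ R (+ k * x) c (trans identity (cong (λ z → c + z) L≡R)))

  x+[t-x]≡t : ∀ x t → x + (t - x) ≡ t
  x+[t-x]≡t = solve-∀

  diffs : List ℤ → List ℤ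
  diffs A = cartesianProductWith _-_ (sums A) A

  obstructions : List ℤ → List (List ℕ)
  obstructions A = roots 1 (diffs A) ∷ roots 2 (sums A) ∷ []

  admissible : ∀ {A} x → All (∣ x ∣ ∉_) (obstructions A) → Admissible x A
  admissible x (x≢e-a All.∷ 2x≢e All.∷ All.[]) =
      (λ {a} a∈A x+a∈ →
         x≢e-a (∈-roots 1 x (∈-cartesianProductWith⁺ _-_ x+a∈ a∈A) (solve (x ∷ a ∷ []))))
    , (λ x+x∈ → 2x≢e (∈-roots 2 x x+x∈ (solve (x ∷ []))))

  -- For a new pair x, v = t - x: each family consists of the roots of one linear equation
  -- k x = c to which a collision between sums of elements of x ∷ v ∷ A reduces.
  pair-obstructions : ℤ → List ℤ → List (List ℕ)
  pair-obstructions t A =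
    roots 1 (cartesianProductWith (λ a e → t + a - e) A (sums A)) ∷
    roots 2 (map (λ e → t + t - e) (sums A)) ∷
    roots 2 [ t ] ∷
    roots 1 A ∷
    roots 3 (map (λ c → t + t - c) A) ∷
    roots 2 (cartesianProductWith (λ c d → t + d - c) A A) ∷
    roots 4 [ t + t ] ∷
    roots 3 (map (λ d → t + d) A) ∷
    obstructions A

  pair-admissible : ∀ {t A} x → t ∉ sums A → All (∣ x ∣ ∉_) (pair-obstructions t A) →
                    Admissible (t - x) A × Admissible x (t - x ∷ A)
  pair-admissible {t} {A} x t∉
    (x≢t+a-e All.∷ 2x≢2t-e All.∷ 2x≢t All.∷ x∉A All.∷
     3x≢2t-c All.∷ 2x≢t+d-c All.∷ 4x≢2t All.∷ 3x≢t+d All.∷ x-avoids) =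
    (v+A∉ , v+v∉) , (x+vA∉ , x+x∉)
    where
    x-admissible : Admissible x A
    x-admissible = admissible x x-avoids

    v+A∉ : ∀ {a} → a ∈ A → t - x + a ∉ sums A
    v+A∉ {a} a∈A e∈ =
      x≢t+a-e (∈-roots 1 x (∈-cartesianProductWith⁺ (λ a e → t + a - e) a∈A e∈)
                           (solve (t ∷ x ∷ a ∷ [])))

    v+v∉ : t - x + (t - x) ∉ sums A
    v+v∉ e∈ = 2x≢2t-e (∈-roots 2 x (∈-map⁺ (λ e → t + t - e) e∈) (solve (t ∷ x ∷ [])))

    x+vA∉ : ∀ {c} → c ∈ t - x ∷ A → x + c ∉ sums (t - x ∷ A)
    x+vA∉ (here refl) e∈ with ∈-sums-∷⁻ {t - x} e∈
    ... | inj₁ eq = 2x≢t (∈-roots′ 2 x {cs = [ t ]} eq (here refl) (solve (t ∷ x ∷ [])))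
    ... | inj₂ (inj₁ (d , d∈A , eq)) = x∉A (∈-roots′ 1 x eq d∈A (solve (t ∷ x ∷ d ∷ [])))
    ... | inj₂ (inj₂ x+v∈) = t∉ (subst (_∈ sums A) (x+[t-x]≡t x t) x+v∈)
    x+vA∉ {c} (there c∈A) e∈ with ∈-sums-∷⁻ {t - x} e∈
    ... | inj₁ eq =
      3x≢2t-c (∈-roots′ 3 x eq (∈-map⁺ (λ c → t + t - c) c∈A) (solve (t ∷ x ∷ c ∷ [])))
    ... | inj₂ (inj₁ (d , d∈A , eq)) =
      2x≢t+d-c (∈-roots′ 2 x eq (∈-cartesianProductWith⁺ (λ c d → t + d - c) c∈A d∈A)
                                 (solve (t ∷ x ∷ c ∷ d ∷ [])))
    ... | inj₂ (inj₂ x+c∈) = proj₁ x-admissible c∈A x+c∈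

    x+x∉ : x + x ∉ sums (t - x ∷ A)
    x+x∉ e∈ with ∈-sums-∷⁻ {t - x} e∈
    ... | inj₁ eq = 4x≢2t (∈-roots′ 4 x {cs = [ t + t ]} eq (here refl) (solve (t ∷ x ∷ [])))
    ... | inj₂ (inj₁ (d , d∈A , eq)) =
      3x≢t+d (∈-roots′ 3 x eq (∈-map⁺ (λ d → t + d) d∈A) (solve (t ∷ x ∷ d ∷ [])))
    ... | inj₂ (inj₂ x+x∈) = proj₂ x-admissible x+x∈

  partner : ℤ → List ℤ → ℤ
  partner t A = + fresh (pair-obstructions t A)

  cover : ℤ → List ℤ → List ℤ
  cover t A with t ∈? sums A
  ... | yes _ = A
  ... | no _ = partner t A ∷ t - partner t A ∷ A

  Sidon-cover : ∀ t {A} → Sidon A → Sidon (cover t A)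
  Sidon-cover t {A} sidon with t ∈? sums A
  ... | yes _ = sidon
  ... | no t∉ with v-admissible , x-admissible ← pair-admissible (partner t A) t∉ (fresh-∉ _) =
    Sidon-∷ (Sidon-∷ sidon v-admissible) x-admissible

  cover-covers : ∀ t A → t ∈ sums (cover t A)
  cover-covers t A with t ∈? sums A
  ... | yes t∈ = t∈
  ... | no _ = ∈-sums⁺ (here refl) (there (here refl)) (sym (x+[t-x]≡t (partner t A) t))

  ⊆-cover : ∀ t A → A ⊆ cover t A
  ⊆-cover t A with t ∈? sums A
  ... | yes _ = λ a∈A → a∈A
  ... | no _ = λ a∈A → there (there a∈A)

  length-cover : ∀ t A → length (cover t A) ℕ.≤ 2 ℕ.+ length A
  length-cover t A with t ∈? sums A
  ... | yes _ = ℕ.m≤n+m (length A) 2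
  ... | no _ = ℕ.≤-refl

  outward : ℤ → ℤ
  outward (+ n) = + suc n
  outward -[1+ n ] = -[1+ suc n ]

  zigzag : ℕ → ℤ
  zigzag zero = + 0
  zigzag (suc zero) = -[1+ 0 ]
  zigzag (suc (suc k)) = outward (zigzag k)

  zigzag-surjective : ∀ z → ∃ λ k → zigzag k ≡ z
  zigzag-surjective (+ zero) = 0 , refl
  zigzag-surjective -[1+ zero ] = 1 , refl
  zigzag-surjective (+ suc n) = Product.map (2 ℕ.+_) (cong outward) (zigzag-surjective (+ n))
  zigzag-surjective -[1+ suc n ] = Product.map (2 ℕ.+_) (cong outward) (zigzag-surjective -[1+ n ])

  stage : ℕ → List ℤ
  covered : ℕ → List ℤ
  witness : ℕ → ℕ

  stage zero = []
  stage (suc k) = + witness k ∷ covered k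
  covered k = cover (zigzag k) (stage k)
  witness k = fresh (obstructions (covered k))

  witness-admissible : ∀ k → Admissible (+ witness k) (covered k)
  witness-admissible k = admissible (+ witness k) (fresh-∉ _)

  Sidon-stage : ∀ k → Sidon (stage k)
  Sidon-stage zero = λ ()
  Sidon-stage (suc k) = Sidon-∷ (Sidon-cover (zigzag k) (Sidon-stage k)) (witness-admissible k)

  stage-mono : ∀ {j k} → j ℕ.≤ k → stage j ⊆ stage k
  stage-mono j≤k = stage-mono′ (ℕ.≤⇒≤′ j≤k)
    where
    stage-mono′ : ∀ {j k} → j ℕ.≤′ k → stage j ⊆ stage k
    stage-mono′ ℕ.≤′-refl = λ a∈ → a∈
    stage-mono′ {k = suc k} (ℕ.≤′-step j≤′k) =
      λ a∈ → there (⊆-cover (zigzag k) (stage k) (stage-mono′ j≤′k a∈))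

  A∞ : SetZ
  A∞ = ⋃ stage

  Sidon-A∞ : SidonSet A∞
  Sidon-A∞ = Sidon-⋃ stage-mono Sidon-stage

  A∞-covers : ∀ n → Rep A∞ n
  A∞-covers n with k , refl ← zigzag-surjective n =
    ∈-sums⇒Rep (λ z∈ → suc k , there z∈) (cover-covers (zigzag k) (stage k))

  witness-∈ : ∀ k → A∞ (+ witness k)
  witness-∈ k = suc k , here refl

  witness-new : ∀ {j k} → j ℕ.< k → witness j ≢ witness k
  witness-new {j} {k} j<k w≡w = Admissible⇒∉ (witness-admissible k)
    (subst (λ w → + w ∈ covered k) w≡w (⊆-cover (zigzag k) (stage k) (stage-mono j<k (here refl))))

  witness-injective : Injective _≡_ _≡_ witness
  witness-injective {j} {k} w≡w with ℕ.<-cmp j k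
  ... | tri< j<k _ _ = ⊥-elim (witness-new j<k w≡w)
  ... | tri≈ _ j≡k _ = j≡k
  ... | tri> _ _ k<j = ⊥-elim (witness-new k<j (sym w≡w))

module Counting where

  open FreshNumbers
  open SidonSets
  open Construction

  open import Data.Nat using (ℕ; zero; suc; _+_; _*_; _^_; _≤_; z≤n; s≤s)
  open import Data.Nat.Properties
  open import Data.Nat.Tactic.RingSolver using (solve-∀)
  open import Data.Integer using (ℤ; +_; +≤+)
  open import Data.Integer.Properties using (+-injective; neg-≤-pos)
  open import Data.Fin using (Fin; toℕ)
  open import Data.Fin.Properties using (toℕ<n; toℕ-injective)
  open import Data.List using ([]; _∷_; _++_; map; length; concat; cartesianProductWith)
  open import Data.List.Properties using (length-++; length-map)
  open import Data.Product using (_,_)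
  open import Function using (_∘_)
  open import Function.Definitions using (Injective)
  open import Relation.Binary.PropositionalEquality
    using (_≡_; refl; cong; cong₂; trans; module ≡-Reasoning)

  length-cartesianProductWith : ∀ {A B C : Set} (f : A → B → C) xs ys →
    length (cartesianProductWith f xs ys) ≡ length xs * length ys
  length-cartesianProductWith f [] ys = refl
  length-cartesianProductWith f (x ∷ xs) ys = begin
    length (map (f x) ys ++ cartesianProductWith f xs ys)
      ≡⟨ length-++ (map (f x) ys) ⟩
    length (map (f x) ys) + length (cartesianProductWith f xs ys)
      ≡⟨ cong₂ _+_ (length-map (f x) ys) (length-cartesianProductWith f xs ys) ⟩
    length ys + length xs * length ys ∎
    where open ≡-Reasoning

  -- The ring solver does not handle _^_, so cubes are spelled out as products.
  cube-expansion : ∀ n → n * n * n + (n * n + 0) + (2 * (n * n) + 3 * n + 1) ≡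
                         (1 + n) * ((1 + n) * ((1 + n) * 1))
  cube-expansion = solve-∀

  length-obstructions : ∀ A → length (concat (obstructions A)) ≤ suc (length A) ^ 3
  length-obstructions A = begin
    length (roots 1 (diffs A) ++ roots 2 (sums A) ++ [])
      ≡⟨ length-++ (roots 1 (diffs A)) ⟩
    length (roots 1 (diffs A)) + length (roots 2 (sums A) ++ [])
      ≡⟨ cong₂ _+_ (length-map _ (diffs A)) (length-++ (roots 2 (sums A))) ⟩
    length (diffs A) + (length (roots 2 (sums A)) + 0)
      ≡⟨ cong₂ (λ p q → p + (q + 0)) |diffs| (trans (length-map _ (sums A)) |sums|) ⟩
    s * s * s + (s * s + 0)
      ≤⟨ m≤m+n _ _ ⟩
    s * s * s + (s * s + 0) + (2 * (s * s) + 3 * s + 1)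
      ≡⟨ cube-expansion s ⟩
    suc s ^ 3 ∎
    where
    open ≤-Reasoning
    s = length A
    |sums| : length (sums A) ≡ s * s
    |sums| = length-cartesianProductWith _ A A
    |diffs| : length (diffs A) ≡ s * s * s
    |diffs| = trans (length-cartesianProductWith _ (sums A) A) (cong (_* s) |sums|)

  stage-length : ∀ k → length (stage k) ≤ 3 * k
  covered-length : ∀ k → suc (length (covered k)) ≤ 3 * suc k

  stage-length zero = z≤n
  stage-length (suc k) = covered-length k

  covered-length k = begin
    suc (length (cover (zigzag k) (stage k))) ≤⟨ s≤s (length-cover (zigzag k) (stage k)) ⟩
    3 + length (stage k)                      ≤⟨ +-monoʳ-≤ 3 (stage-length k) ⟩
    3 + 3 * k                                 ≡⟨ *-suc 3 k ⟨
    3 * suc k                                 ∎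
    where open ≤-Reasoning

  witness-bound : ∀ k → witness k ≤ (3 * suc k) ^ 3
  witness-bound k = begin
    witness k                         ≤⟨ fresh-≤ (obstructions (covered k)) ⟩
    length (concat (obstructions (covered k))) ≤⟨ length-obstructions (covered k) ⟩
    suc (length (covered k)) ^ 3      ≤⟨ ^-monoˡ-≤ 3 (covered-length k) ⟩
    (3 * suc k) ^ 3                   ∎
    where open ≤-Reasoning

  witnesses-within : ∀ n m → (4 * m) ^ 3 ≤ n → AtLeast A∞ n m
  witnesses-within n m [4m]³≤n =
    f , f-injective , λ i → witness-∈ (toℕ i) , neg-≤-pos , +≤+ (witness-≤n i)
    where
    f : Fin m → ℤ
    f i = + witness (toℕ i)
    f-injective : Injective _≡_ _≡_ f
    f-injective = toℕ-injective ∘ witness-injective ∘ +-injective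
    witness-≤n : ∀ i → witness (toℕ i) ≤ n
    witness-≤n i = begin
      witness (toℕ i)      ≤⟨ witness-bound (toℕ i) ⟩
      (3 * suc (toℕ i)) ^ 3 ≤⟨ ^-monoˡ-≤ 3 (*-mono-≤ (n≤1+n 3) (toℕ<n i)) ⟩
      (4 * m) ^ 3          ≤⟨ [4m]³≤n ⟩
      n                    ∎
      where open ≤-Reasoning

module CubeRoots where

  open import Data.Nat
  open import Data.Nat.Properties
  open import Data.Nat.Tactic.RingSolver using (solve-∀)
  open import Data.Product using (∃; _×_; _,_)
  open import Data.Empty using (⊥-elim)
  open import Relation.Nullary using (yes; no)
  open import Relation.Binary.PropositionalEquality using (_≡_; refl; subst)

  bracket : (f : ℕ → ℕ) → f 0 ≡ 0 → (∀ m → f m < f (suc m)) →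
            ∀ n → ∃ λ m → f m ≤ n × n < f (suc m)
  bracket f f0≡0 f-step zero = 0 , ≤-reflexive f0≡0 , subst (_< f 1) f0≡0 (f-step 0)
  bracket f f0≡0 f-step (suc n) with bracket f f0≡0 f-step n
  ... | m , fm≤n , n<f[1+m] with suc n <? f (suc m)
  ...   | yes 1+n<f[1+m] = m , m≤n⇒m≤1+n fm≤n , 1+n<f[1+m]
  ...   | no 1+n≮f[1+m] =
    suc m , ≤-reflexive f[1+m]≡1+n , subst (_< f (2 + m)) f[1+m]≡1+n (f-step (suc m))
    where
    f[1+m]≡1+n : f (suc m) ≡ suc n
    f[1+m]≡1+n = ≤-antisym (≮⇒≥ 1+n≮f[1+m]) n<f[1+m]

  cube-of-double : ∀ m → 4 * (m + m) * (4 * (m + m) * (4 * (m + m) * 1)) ≡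
                         512 * (m * (m * (m * 1)))
  cube-of-double = solve-∀

  cube-bracket : ∀ n → 64 ≤ n → ∃ λ m → (4 * m) ^ 3 ≤ n × n + 1 ≤ 512 * m ^ 3
  cube-bracket n 64≤n
    with bracket (λ m → (4 * m) ^ 3) refl (λ m → ^-monoˡ-< 3 (*-monoʳ-< 4 (n<1+n m))) n
  ... | zero , _ , n<64 = ⊥-elim (<⇒≱ n<64 64≤n)
  ... | suc m , [4m]³≤n , n<[4m+4]³ = suc m , [4m]³≤n , n+1≤512m³
    where
    open ≤-Reasoning
    n+1≤512m³ : n + 1 ≤ 512 * suc m ^ 3
    n+1≤512m³ = begin
      n + 1                       ≡⟨ +-comm n 1 ⟩
      suc n                       ≤⟨ n<[4m+4]³ ⟩
      (4 * (2 + m)) ^ 3           ≤⟨ ^-monoˡ-≤ 3 (*-monoʳ-≤ 4 (s≤s (m≤n+m (suc m) m))) ⟩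
      (4 * (suc m + suc m)) ^ 3   ≡⟨ cube-of-double (suc m) ⟩
      512 * suc m ^ 3             ∎

open SidonSets using (Sidon⇒UniqueRep)
open Construction using (A∞; Sidon-A∞; A∞-covers)
open Counting using (witnesses-within)
open CubeRoots using (cube-bracket)
open import Data.Nat using (ℕ; _≤_; _*_; _^_; _+_)
open import Data.Product using (Σ; _×_; _,_)

theorem1p1 : Σ SetZ λ A → IsUniqueRepBasis A ×
               Σ ℕ λ N → ∀ n → N ≤ n →
                 Σ ℕ λ m → AtLeast A n m × (n + 1 ≤ 512 * m ^ 3)
theorem1p1 = A∞ , (λ n → Sidon⇒UniqueRep Sidon-A∞ (A∞-covers n)) , 64 , dense
  where
  dense : ∀ n → 64 ≤ n → Σ ℕ λ m → AtLeast A∞ n m × (n + 1 ≤ 512 * m ^ 3)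
  dense n 64≤n with m , [4m]³≤n , n+1≤512m³ ← cube-bracket n 64≤n =
    m , witnesses-within n m [4m]³≤n , n+1≤512m³
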